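{- Let $k\ge 2$ be an integer. Then for all $n\ge 0$, the number of forests on $[n]$ that avoid both $12$ and $k(k-1)\cdots 1$ equals $(S_{k-2})_n$, where $S_i$ denotes the sequence of $i$th-order Bell numbers.
   Context: A forest on $[n]$ is an unordered rooted forest with $n$ vertices labeled bijectively by $1,\dots,n$ (the empty forest for $n=0$). An instance of $\sigma\in\mathcal{S}_j$ is a sequence of vertices $v_1,\dots,v_j$ with $v_a$ a strict ancestor of $v_b$ for $a<b$ and labels in the same relative order as $\sigma$; the forest avoids $\sigma$ if there is no instance. The Bell transform of a sequence $a_0,a_1,\dots$ is the triangular array $\Delta(n,m)$, $0\le m\le n$, defined by $\Delta(0,0)=1$, $\Delta(n,0)=0$ and $\Delta(n,1)=a_{n-1}$ for $n\ge 1$, and $\Delta(n,m)=\sum_{j=1}^{n-m+1}\binom{n-1}{j-1}\Delta(n-j,m-1)\Delta(j,1)$ for $2\le m\le n$. Let $S_0$ be the constant sequence $(S_0)_n=1$; for $i\ge 0$ let $\Delta_i$ be the Bell transform of $S_i$ and let $S_{i+1}$ be its row-sum sequence, $(S_{i+1})_n=\sum_{m=0}^n\Delta_i(n,m)$. The sequence $S_i$ is the sequence of $i$th-order Bell numbers. -}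

module Defs where

open import Data.Nat using (ℕ; zero; suc; _+_; _*_; _∸_; _<_; _≤_)
open import Data.Nat.Combinatorics using (_C_)
open import Data.Fin using (Fin; toℕ)
open import Data.Fin.Base using () renaming (_<_ to _<ᶠ_)
open import Data.Maybe using (Maybe; just; nothing)
open import Data.Vec using (Vec; lookup)
open import Data.Product using (Σ; _×_; ∃)
open import Relation.Binary.PropositionalEquality using (_≡_)
open import Relation.Nullary using (¬_)
open import Function.Bundles using (_⇔_)

-- A (labeled, unordered, rooted) forest on [n] is represented by its
-- parent vector: vertex v : Fin n (label toℕ v + 1) has parent
-- lookup p v = just u, or is a root when lookup p v = nothing.
-- Such a vector is a forest iff it has no cycles, i.e. from every
-- vertex the chain of parents reaches a root within n steps.

Parent : ℕ → Set
Parent n = Vec (Maybe (Fin n)) n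

up : ∀ {n} → Parent n → Maybe (Fin n) → Maybe (Fin n)
up p nothing  = nothing
up p (just v) = lookup p v

upⁿ : ∀ {n} → Parent n → ℕ → Maybe (Fin n) → Maybe (Fin n)
upⁿ p zero    x = x
upⁿ p (suc m) x = up p (upⁿ p m x)

IsForest : ∀ {n} → Parent n → Set
IsForest {n} p = ∀ (v : Fin n) → upⁿ p n (just v) ≡ nothing

StrictAnc : ∀ {n} → Parent n → Fin n → Fin n → Set
StrictAnc p u v = ∃ λ m → upⁿ p (suc m) (just v) ≡ just u

-- A pattern σ ∈ S_j is given by its values σ : Fin j → ℕ
-- (σ a is the value at position a; only the relative order matters).

Instance : ∀ {n j} → Parent n → (Fin j → ℕ) → (Fin j → Fin n) → Set
Instance p σ v =
  ∀ a b → a <ᶠ b →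
    StrictAnc p (v a) (v b) × ((toℕ (v a) < toℕ (v b)) ⇔ (σ a < σ b))

Avoids : ∀ {n j} → Parent n → (Fin j → ℕ) → Set
Avoids {n} {j} p σ = ¬ (Σ (Fin j → Fin n) λ v → Instance p σ v)

pat12 : Fin 2 → ℕ
pat12 a = suc (toℕ a)

patDec : (k : ℕ) → Fin k → ℕ
patDec k a = k ∸ toℕ a

sumFrom1 : ℕ → (ℕ → ℕ) → ℕ
sumFrom1 zero    f = 0
sumFrom1 (suc N) f = sumFrom1 N f + f (suc N)

sumFrom0 : ℕ → (ℕ → ℕ) → ℕ
sumFrom0 N f = f 0 + sumFrom1 N f

-- BellΔ a n m = Δ(n,m) for the Bell transform of the sequence a.
-- (Values with m > n are irrelevant; they are never used.)
-- For m ≥ 2:  Δ(n,m) = Σ_{j=1}^{n-m+1} C(n-1,j-1) Δ(n-j,m-1) Δ(j,1),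
-- with Δ(j,1) = a_{j-1} for j ≥ 1.
BellΔ : (ℕ → ℕ) → ℕ → ℕ → ℕ
BellΔ a zero    zero                = 1
BellΔ a (suc n) zero                = 0
BellΔ a zero    (suc m)             = 0
BellΔ a (suc n) (suc zero)          = a n
BellΔ a (suc n) (suc (suc m))       =
  sumFrom1 (suc n ∸ suc (suc m) + 1) λ j →
    (n C (j ∸ 1)) * BellΔ a (suc n ∸ j) (suc m) * a (j ∸ 1)

rowSum : (ℕ → ℕ) → ℕ → ℕ
rowSum a n = sumFrom0 n (BellΔ a n)

S : ℕ → ℕ → ℕ
S zero    n = 1
S (suc i) n = rowSum (S i) n

-- A forest avoids 12 exactly when every parent carries a larger label than its
-- children, and then it avoids k(k-1)⋯1 exactly when its height is below k.
-- Such decreasing forests of height ≤ h on n+1 vertices decompose at the root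
-- carrying the largest label: removing it leaves a decreasing forest of height
-- ≤ h-1 on the j-set of its descendants, and the other n-j vertices form a
-- decreasing forest of height ≤ h.  Their numbers Z_h(n) therefore satisfy
-- Z_h(n+1) = Σ_j C(n,j) Z_{h-1}(j) Z_h(n-j), which is also the recurrence of the
-- row sums of the Bell transform: S_h(n+1) = Σ_j C(n,j) S_{h-1}(j) S_h(n-j).
module Submission where

open import Defs
open import Data.Nat using (ℕ; _≤_; _∸_)
open import Data.List using (List; length)
open import Data.List.Membership.Propositional using (_∈_)
open import Data.List.Relation.Unary.Unique.Propositional using (Unique)
open import Data.Product using (Σ; _×_)
open import Relation.Binary.PropositionalEquality using (_≡_)
open import Function.Bundles using (_⇔_)

open import Data.Bool using (Bool; true; false)
open import Data.Empty using (⊥; ⊥-elim)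
open import Data.Fin using (Fin; zero; suc; toℕ; fromℕ; fromℕ<; inject₁)
open import Data.Fin.Properties using (toℕ-injective; toℕ<n; toℕ-fromℕ<; fromℕ≢inject₁; inject₁-injective)
import Data.Fin.Properties as Fin
open import Data.List using ([]; _∷_; _++_; map; concatMap; cartesianProductWith)
open import Data.Nat.ListAction using (sum)
open import Data.Nat.ListAction.Properties using (sum-++)
open import Data.List.Membership.Propositional using (find; lose)
open import Data.List.Membership.Propositional.Properties
  using (∈-map⁺; ∈-map⁻; ∈-++⁺ˡ; ∈-++⁺ʳ; ∈-concatMap⁺; ∈-concatMap⁻; ∈-cartesianProductWith⁺; ∈-cartesianProductWith⁻)
open import Data.List.Properties using (length-map; length-++; map-++; map-∘; map-cong)
open import Data.List.Relation.Unary.Any using (here)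
import Data.List.Relation.Unary.All as All
import Data.List.Relation.Unary.All.Properties as All
import Data.List.Relation.Unary.AllPairs as AllPairs
import Data.List.Relation.Unary.AllPairs.Properties as AllPairs
import Data.List.Relation.Unary.Unique.Propositional.Properties as Unique
open import Data.Maybe using (Maybe; just; nothing)
open import Data.Maybe.Properties using (just-injective)
import Data.Maybe as Maybe
open import Data.Nat using (zero; suc; _+_; _*_; _<_; _≤′_; ≤′-refl; ≤′-step; z≤n; s≤s; s≤s⁻¹; _≤?_)
open import Data.Nat.Combinatorics using (_C_; nCn≡1; k>n⇒nCk≡0; nCk+nC[k+1]≡[n+1]C[k+1])
open import Data.Nat.Properties
open import Algebra.Properties.CommutativeSemigroup +-commutativeSemigroup
  using (interchange; x∙yz≈y∙xz)
open import Algebra.Properties.CommutativeSemigroup *-commutativeSemigroup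
  using () renaming (xy∙z≈xz∙y to *-swapʳ)
open import Data.Product using (_,_; proj₁; proj₂; ∃; ∃₂)
open import Data.Vec using (Vec; []; _∷_; lookup)
import Data.Vec as Vec
import Data.Vec.Properties as Vec
open import Function using (_∘_)
open import Function.Bundles using (mk⇔; Equivalence)
open import Relation.Binary.Definitions using (tri<; tri≈; tri>)
open import Relation.Binary.PropositionalEquality using (refl; sym; trans; cong; cong₂; subst; subst₂; _≢_; module ≡-Reasoning)
open import Relation.Nullary using (¬_; yes; no)

sumBelow : ℕ → (ℕ → ℕ) → ℕ
sumBelow zero    f = 0
sumBelow (suc N) f = sumBelow N f + f N

sumBelow-cong : ∀ N {f g : ℕ → ℕ} → (∀ i → i < N → f i ≡ g i) → sumBelow N f ≡ sumBelow N g
sumBelow-cong zero    f≡g = refl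
sumBelow-cong (suc N) f≡g =
  cong₂ _+_ (sumBelow-cong N (λ i i<N → f≡g i (m<n⇒m<1+n i<N))) (f≡g N ≤-refl)

sumBelow-zero : ∀ N {f : ℕ → ℕ} → (∀ i → i < N → f i ≡ 0) → sumBelow N f ≡ 0
sumBelow-zero zero    f≡0 = refl
sumBelow-zero (suc N) f≡0 =
  cong₂ _+_ (sumBelow-zero N (λ i i<N → f≡0 i (m<n⇒m<1+n i<N))) (f≡0 N ≤-refl)

sumBelow-+ : ∀ N f g → sumBelow N (λ i → f i + g i) ≡ sumBelow N f + sumBelow N g
sumBelow-+ zero    f g = refl
sumBelow-+ (suc N) f g =
  trans (cong (_+ (f N + g N)) (sumBelow-+ N f g)) (interchange (sumBelow N f) (sumBelow N g) (f N) (g N))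

sumBelow-*ˡ : ∀ N c f → sumBelow N (λ i → c * f i) ≡ c * sumBelow N f
sumBelow-*ˡ zero    c f = sym (*-zeroʳ c)
sumBelow-*ˡ (suc N) c f =
  trans (cong (_+ c * f N) (sumBelow-*ˡ N c f)) (sym (*-distribˡ-+ c (sumBelow N f) (f N)))

sumBelow-swap : ∀ N M (f : ℕ → ℕ → ℕ) →
  sumBelow N (λ i → sumBelow M (f i)) ≡ sumBelow M (λ j → sumBelow N (λ i → f i j))
sumBelow-swap zero    M f = sym (sumBelow-zero M (λ _ _ → refl))
sumBelow-swap (suc N) M f =
  trans (cong (_+ sumBelow M (f N)) (sumBelow-swap N M f))
        (sym (sumBelow-+ M (λ j → sumBelow N (λ i → f i j)) (f N)))

sumBelow-suc : ∀ N f → sumBelow (suc N) f ≡ f 0 + sumBelow N (f ∘ suc)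
sumBelow-suc zero    f = +-comm 0 (f 0)
sumBelow-suc (suc N) f =
  trans (cong (_+ f (suc N)) (sumBelow-suc N f)) (+-assoc (f 0) _ (f (suc N)))

sumBelow-extend : ∀ {N N′} f → N ≤ N′ → (∀ i → N ≤ i → i < N′ → f i ≡ 0) →
  sumBelow N f ≡ sumBelow N′ f
sumBelow-extend f N≤N′ = go (≤⇒≤′ N≤N′)
  where
  go : ∀ {N N′} → N ≤′ N′ → (∀ i → N ≤ i → i < N′ → f i ≡ 0) → sumBelow N f ≡ sumBelow N′ f
  go ≤′-refl           _   = refl
  go {N} {suc N′} (≤′-step N≤′N′) f≡0 = begin
    sumBelow N f            ≡⟨ go N≤′N′ (λ i N≤i i<N′ → f≡0 i N≤i (m<n⇒m<1+n i<N′)) ⟩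
    sumBelow N′ f           ≡⟨ +-identityʳ _ ⟨
    sumBelow N′ f + 0       ≡⟨ cong (sumBelow N′ f +_) (f≡0 N′ (≤′⇒≤ N≤′N′) ≤-refl) ⟨
    sumBelow N′ f + f N′    ∎
    where open ≡-Reasoning

sumFrom1≡sumBelow : ∀ N f → sumFrom1 N f ≡ sumBelow N (f ∘ suc)
sumFrom1≡sumBelow zero    f = refl
sumFrom1≡sumBelow (suc N) f = cong (_+ f (suc N)) (sumFrom1≡sumBelow N f)

sumFrom0≡sumBelow : ∀ N f → sumFrom0 N f ≡ sumBelow (suc N) f
sumFrom0≡sumBelow N f = trans (cong (f 0 +_) (sumFrom1≡sumBelow N f)) (sym (sumBelow-suc N f))

binomialSum : ℕ → (ℕ → ℕ → ℕ) → ℕ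
binomialSum n F = sumBelow (suc n) (λ j → (n C j) * F j (n ∸ j))

-- Pascal's rule, summed: the new element is counted either by the first or by
-- the second argument of F.
binomialSum-suc : ∀ n F →
  binomialSum (suc n) F ≡ binomialSum n (λ i j → F (suc i) j) + binomialSum n (λ i j → F i (suc j))
binomialSum-suc n F = begin
  binomialSum (suc n) F
    ≡⟨ sumBelow-suc (suc n) _ ⟩
  1 * G 0 + sumBelow (suc n) (λ j → (suc n C suc j) * G (suc j))
    ≡⟨ cong (1 * G 0 +_) (sumBelow-cong (suc n) (λ j _ → pascal j)) ⟩
  1 * G 0 + sumBelow (suc n) (λ j → (n C j) * G (suc j) + (n C suc j) * G (suc j))
    ≡⟨ cong (1 * G 0 +_) (sumBelow-+ (suc n) _ _) ⟩
  1 * G 0 + (A + sumBelow (suc n) (λ j → (n C suc j) * G (suc j)))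
    ≡⟨ x∙yz≈y∙xz (1 * G 0) A _ ⟩
  A + (1 * G 0 + sumBelow (suc n) (λ j → (n C suc j) * G (suc j)))
    ≡⟨ cong (A +_) (sumBelow-suc (suc n) _) ⟨
  A + sumBelow (suc (suc n)) (λ j → (n C j) * G j)
    ≡⟨ cong (A +_) lastTermVanishes ⟩
  A + binomialSum n (λ i j → F i (suc j))
    ∎
  where
  open ≡-Reasoning
  G : ℕ → ℕ
  G j = F j (suc n ∸ j)
  A : ℕ
  A = binomialSum n (λ i j → F (suc i) j)
  pascal : ∀ j → (suc n C suc j) * G (suc j) ≡ (n C j) * G (suc j) + (n C suc j) * G (suc j)
  pascal j = trans (cong (_* G (suc j)) (sym (nCk+nC[k+1]≡[n+1]C[k+1] n j)))
                   (*-distribʳ-+ (G (suc j)) (n C j) (n C suc j))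
  lastTermVanishes : sumBelow (suc (suc n)) (λ j → (n C j) * G j) ≡ binomialSum n (λ i j → F i (suc j))
  lastTermVanishes = begin
    sumBelow (suc n) (λ j → (n C j) * G j) + (n C suc n) * G (suc n)
      ≡⟨ cong (λ c → sumBelow (suc n) (λ j → (n C j) * G j) + c * G (suc n)) (k>n⇒nCk≡0 (n<1+n n)) ⟩
    sumBelow (suc n) (λ j → (n C j) * G j) + 0
      ≡⟨ +-identityʳ _ ⟩
    sumBelow (suc n) (λ j → (n C j) * G j)
      ≡⟨ sumBelow-cong (suc n) (λ j j≤n → cong (λ x → (n C j) * F j x) (+-∸-assoc 1 (s≤s⁻¹ j≤n))) ⟩
    binomialSum n (λ i j → F i (suc j))
      ∎

n∸[1+m]<j⇒n∸j≤m : ∀ n m j → n ∸ suc m < j → n ∸ j ≤ m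
n∸[1+m]<j⇒n∸j≤m n m j lt = m≤n+o⇒m∸n≤o n j (begin
  n                  ≤⟨ m≤n+m∸n n (suc m) ⟩
  suc m + (n ∸ suc m) ≡⟨ +-suc m _ ⟨
  m + suc (n ∸ suc m) ≤⟨ +-monoʳ-≤ m lt ⟩
  m + j              ≡⟨ +-comm m j ⟩
  j + m              ∎)
  where open ≤-Reasoning

-- Row sums of the Bell transform

module _ (a : ℕ → ℕ) where

  BellΔ-vanishes : ∀ {n m} → n < m → BellΔ a n m ≡ 0
  BellΔ-vanishes {zero}  {suc m}        _              = refl
  BellΔ-vanishes {suc n} {suc (suc m)} (s≤s n<1+m)
    rewrite m≤n⇒m∸n≡0 (m<n⇒m<1+n n<1+m) | BellΔ-vanishes n<1+m = refl

  BellΔ-suc : ∀ n m → BellΔ a (suc n) (suc m) ≡ sumBelow (suc n) (λ j → (n C j) * BellΔ a (n ∸ j) m * a j)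
  BellΔ-suc n zero = sym (begin
    sumBelow n g + g n  ≡⟨ cong (_+ g n) (sumBelow-zero n nonRootTerm) ⟩
    g n                 ≡⟨ cong₂ (λ c x → c * BellΔ a x 0 * a n) (nCn≡1 n) (n∸n≡0 n) ⟩
    1 * 1 * a n         ≡⟨ +-identityʳ (a n) ⟩
    a n                 ∎)
    where
    open ≡-Reasoning
    g : ℕ → ℕ
    g j = (n C j) * BellΔ a (n ∸ j) 0 * a j
    nonRootTerm : ∀ j → j < n → g j ≡ 0
    nonRootTerm j j<n = trans (cong (λ t → (n C j) * t * a j) (emptyColumn (m<n⇒0<n∸m j<n)))
                              (cong (_* a j) (*-zeroʳ (n C j)))
      where
      emptyColumn : ∀ {x} → 0 < x → BellΔ a x 0 ≡ 0
      emptyColumn {suc _} _ = refl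
  BellΔ-suc n (suc m) = begin
    BellΔ a (suc n) (suc (suc m))  ≡⟨ sumFrom1≡sumBelow (n ∸ suc m + 1) _ ⟩
    sumBelow (n ∸ suc m + 1) g     ≡⟨ sumBelow-extend g bound vanishes ⟩
    sumBelow (suc n) g             ∎
    where
    open ≡-Reasoning
    g : ℕ → ℕ
    g j = (n C j) * BellΔ a (n ∸ j) (suc m) * a j
    bound : n ∸ suc m + 1 ≤ suc n
    bound = ≤-trans (+-monoˡ-≤ 1 (m∸n≤m n (suc m))) (≤-reflexive (+-comm n 1))
    n∸j≤m : ∀ j → n ∸ suc m + 1 ≤ j → n ∸ j ≤ m
    n∸j≤m j lo = n∸[1+m]<j⇒n∸j≤m n m j (≤-trans (≤-reflexive (+-comm 1 _)) lo)
    vanishes : ∀ j → n ∸ suc m + 1 ≤ j → j < suc n → g j ≡ 0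
    vanishes j lo _ rewrite BellΔ-vanishes (s≤s (n∸j≤m j lo)) = cong (_* a j) (*-zeroʳ (n C j))

  rowSum-suc : ∀ n → rowSum a (suc n) ≡ sumBelow (suc n) (λ j → (n C j) * a j * rowSum a (n ∸ j))
  rowSum-suc n = begin
    rowSum a (suc n)
      ≡⟨ sumFrom1≡sumBelow (suc n) (BellΔ a (suc n)) ⟩
    sumBelow (suc n) (λ m → BellΔ a (suc n) (suc m))
      ≡⟨ sumBelow-cong (suc n) (λ m _ → BellΔ-suc n m) ⟩
    sumBelow (suc n) (λ m → sumBelow (suc n) (λ j → (n C j) * BellΔ a (n ∸ j) m * a j))
      ≡⟨ sumBelow-swap (suc n) (suc n) _ ⟩
    sumBelow (suc n) (λ j → sumBelow (suc n) (λ m → (n C j) * BellΔ a (n ∸ j) m * a j))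
      ≡⟨ sumBelow-cong (suc n) (λ j j≤n → column j (s≤s⁻¹ j≤n)) ⟩
    sumBelow (suc n) (λ j → (n C j) * a j * rowSum a (n ∸ j))
      ∎
    where
    open ≡-Reasoning
    column : ∀ j → j ≤ n → sumBelow (suc n) (λ m → (n C j) * BellΔ a (n ∸ j) m * a j) ≡ (n C j) * a j * rowSum a (n ∸ j)
    column j j≤n = begin
      sumBelow (suc n) (λ m → (n C j) * BellΔ a (n ∸ j) m * a j)
        ≡⟨ sumBelow-cong (suc n) (λ m _ → *-swapʳ (n C j) _ (a j)) ⟩
      sumBelow (suc n) (λ m → (n C j) * a j * BellΔ a (n ∸ j) m)
        ≡⟨ sumBelow-*ˡ (suc n) ((n C j) * a j) _ ⟩
      (n C j) * a j * sumBelow (suc n) (BellΔ a (n ∸ j))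
        ≡⟨ cong ((n C j) * a j *_) (sumBelow-extend _ (s≤s (m∸n≤m n j)) (λ m n∸j<m _ → BellΔ-vanishes n∸j<m)) ⟨
      (n C j) * a j * sumBelow (suc (n ∸ j)) (BellΔ a (n ∸ j))
        ≡⟨ cong ((n C j) * a j *_) (sumFrom0≡sumBelow (n ∸ j) _) ⟨
      (n C j) * a j * rowSum a (n ∸ j)
        ∎

decForestCount : ℕ → ℕ → ℕ
decForestCount zero    zero    = 1
decForestCount zero    (suc n) = 0
decForestCount (suc h) n       = S h n

decForestCount-suc : ∀ h n →
  decForestCount (suc h) (suc n) ≡ binomialSum n (λ i j → decForestCount h i * decForestCount (suc h) j)
decForestCount-suc zero n = sym (begin
  binomialSum n (λ i j → decForestCount zero i * 1)
    ≡⟨ sumBelow-suc n _ ⟩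
  1 * (1 * 1) + sumBelow n (λ j → (n C suc j) * (0 * 1))
    ≡⟨ cong (1 +_) (sumBelow-zero n (λ j _ → *-zeroʳ (n C suc j))) ⟩
  1 ∎)
  where open ≡-Reasoning
decForestCount-suc (suc h) n =
  trans (rowSum-suc (S h) n) (sumBelow-cong (suc n) (λ j _ → *-assoc (n C j) _ _))

trues : ∀ {n} → Vec Bool n → ℕ
trues []          = 0
trues (true  ∷ s) = suc (trues s)
trues (false ∷ s) = trues s

falses : ∀ {n} → Vec Bool n → ℕ
falses []          = 0
falses (true  ∷ s) = falses s
falses (false ∷ s) = suc (falses s)

trues≤ : ∀ {n} (s : Vec Bool n) → trues s ≤ n
trues≤ []          = z≤n
trues≤ (true  ∷ s) = s≤s (trues≤ s)
trues≤ (false ∷ s) = m≤n⇒m≤1+n (trues≤ s)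

falses≤ : ∀ {n} (s : Vec Bool n) → falses s ≤ n
falses≤ []          = z≤n
falses≤ (true  ∷ s) = m≤n⇒m≤1+n (falses≤ s)
falses≤ (false ∷ s) = s≤s (falses≤ s)

boolVectors : ∀ n → List (Vec Bool n)
boolVectors zero    = [] ∷ []
boolVectors (suc n) = map (true ∷_) (boolVectors n) ++ map (false ∷_) (boolVectors n)

∈-boolVectors : ∀ {n} (s : Vec Bool n) → s ∈ boolVectors n
∈-boolVectors []          = here refl
∈-boolVectors (true  ∷ s) = ∈-++⁺ˡ (∈-map⁺ (true ∷_) (∈-boolVectors s))
∈-boolVectors (false ∷ s) = ∈-++⁺ʳ _ (∈-map⁺ (false ∷_) (∈-boolVectors s))

boolVectors-unique : ∀ n → Unique (boolVectors n)
boolVectors-unique zero    = All.[] AllPairs.∷ AllPairs.[]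
boolVectors-unique (suc n) =
  Unique.++⁺ (Unique.map⁺ Vec.∷-injectiveʳ (boolVectors-unique n)) (Unique.map⁺ Vec.∷-injectiveʳ (boolVectors-unique n))
             headsDiffer
  where
  headsDiffer : ∀ {s} → ¬ (s ∈ map (true ∷_) (boolVectors n) × s ∈ map (false ∷_) (boolVectors n))
  headsDiffer (t , f) with ∈-map⁻ (true ∷_) t | ∈-map⁻ (false ∷_) f
  ... | _ , _ , refl | _ , _ , ()

sum-boolVectors : ∀ n F → sum (map (λ s → F (trues s) (falses s)) (boolVectors n)) ≡ binomialSum n F
sum-boolVectors zero    F = refl
sum-boolVectors (suc n) F = begin
  sum (map G (map (true ∷_) V ++ map (false ∷_) V))
    ≡⟨ cong sum (map-++ G (map (true ∷_) V) _) ⟩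
  sum (map G (map (true ∷_) V) ++ map G (map (false ∷_) V))
    ≡⟨ sum-++ (map G (map (true ∷_) V)) _ ⟩
  sum (map G (map (true ∷_) V)) + sum (map G (map (false ∷_) V))
    ≡⟨ cong₂ _+_ (cong sum (map-∘ V)) (cong sum (map-∘ V)) ⟨
  sum (map (G ∘ (true ∷_)) V) + sum (map (G ∘ (false ∷_)) V)
    ≡⟨ cong₂ _+_ (sum-boolVectors n (λ i j → F (suc i) j)) (sum-boolVectors n (λ i j → F i (suc j))) ⟩
  binomialSum n (λ i j → F (suc i) j) + binomialSum n (λ i j → F i (suc j))
    ≡⟨ binomialSum-suc n F ⟨
  binomialSum (suc n) F
    ∎
  where
  open ≡-Reasoning
  V : List (Vec Bool n)
  V = boolVectors n
  G : Vec Bool (suc n) → ℕ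
  G s = F (trues s) (falses s)

-- Decreasing forests

-- The head is the parent of the vertex with the smallest label, given as a
-- vertex of the forest on the remaining labels (compare toParent below).
data DecForest : ℕ → Set where
  []  : DecForest 0
  _∷_ : ∀ {n} → Maybe (Fin n) → DecForest n → DecForest (suc n)

∷-injective : ∀ {n} {c c′ : Maybe (Fin n)} {d d′} → _≡_ {A = DecForest (suc n)} (c ∷ d) (c′ ∷ d′) → c ≡ c′ × d ≡ d′
∷-injective refl = refl , refl

depth : ∀ {n} → DecForest n → Fin n → ℕ
depth (_       ∷ d) (suc v) = depth d v
depth (nothing ∷ d) zero    = 1
depth (just u  ∷ d) zero    = suc (depth d u)

depth≥1 : ∀ {n} (d : DecForest n) v → 1 ≤ depth d v
depth≥1 (_       ∷ d) (suc v) = depth≥1 d v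
depth≥1 (nothing ∷ d) zero    = s≤s z≤n
depth≥1 (just _  ∷ d) zero    = s≤s z≤n

HeightAtMost : ℕ → ∀ {n} → DecForest n → Set
HeightAtMost h d = ∀ v → depth d v ≤ h

-- The vector marks which of the vertices 0 … n-1 lie below the root n; the two
-- forests are the one below that root and the one on the remaining vertices.
Decomposition : ℕ → Set
Decomposition n = Σ (Vec Bool n) λ s → DecForest (trues s) × DecForest (falses s)

nthTrue : ∀ {n} (s : Vec Bool n) → Fin (trues s) → Fin n
nthTrue (true  ∷ s) zero    = zero
nthTrue (true  ∷ s) (suc a) = suc (nthTrue s a)
nthTrue (false ∷ s) a       = suc (nthTrue s a)

nthFalse : ∀ {n} (s : Vec Bool n) → Fin (falses s) → Fin n
nthFalse (true  ∷ s) b       = suc (nthFalse s b)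
nthFalse (false ∷ s) zero    = zero
nthFalse (false ∷ s) (suc b) = suc (nthFalse s b)

parentOfTrue : ∀ {n} (s : Vec Bool n) → Maybe (Fin (trues s)) → Maybe (Fin (suc n))
parentOfTrue {n} s nothing  = just (fromℕ n)
parentOfTrue     s (just a) = just (inject₁ (nthTrue s a))

parentOfFalse : ∀ {n} (s : Vec Bool n) → Maybe (Fin (falses s)) → Maybe (Fin (suc n))
parentOfFalse s nothing  = nothing
parentOfFalse s (just b) = just (inject₁ (nthFalse s b))

merge : ∀ {n} → Decomposition n → DecForest (suc n)
merge ([]        , []    , [])    = nothing ∷ []
merge (true  ∷ s , c ∷ f , g)     = parentOfTrue s c ∷ merge (s , f , g)
merge (false ∷ s , f     , c ∷ g) = parentOfFalse s c ∷ merge (s , f , g)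

data Position {n} (s : Vec Bool n) : Fin (suc n) → Set where
  isMax   : Position s (fromℕ n)
  isTrue  : (a : Fin (trues s))  → Position s (inject₁ (nthTrue s a))
  isFalse : (b : Fin (falses s)) → Position s (inject₁ (nthFalse s b))

position : ∀ {n} (s : Vec Bool n) (u : Fin (suc n)) → Position s u
position []          zero    = isMax
position (true  ∷ s) zero    = isTrue zero
position (false ∷ s) zero    = isFalse zero
position (x ∷ s)     (suc u) with position s u
position (x     ∷ s) (suc .(fromℕ _))                 | isMax     = isMax
position (true  ∷ s) (suc .(inject₁ (nthTrue s a)))  | isTrue a  = isTrue (suc a)
position (false ∷ s) (suc .(inject₁ (nthTrue s a)))  | isTrue a  = isTrue a
position (true  ∷ s) (suc .(inject₁ (nthFalse s b))) | isFalse b = isFalse b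
position (false ∷ s) (suc .(inject₁ (nthFalse s b))) | isFalse b = isFalse (suc b)

merge-surjective : ∀ {n} (d : DecForest (suc n)) → ∃ λ (t : Decomposition n) → merge t ≡ d
merge-surjective {zero}  (nothing ∷ []) = ([] , [] , []) , refl
merge-surjective {suc n} (c ∷ d) with merge-surjective d
merge-surjective {suc n} (nothing ∷ .(merge (s , f , g))) | (s , f , g) , refl =
  (false ∷ s , f , nothing ∷ g) , refl
merge-surjective {suc n} (just u  ∷ .(merge (s , f , g))) | (s , f , g) , refl with position s u
... | isMax     = (true  ∷ s , nothing ∷ f , g)     , refl
... | isTrue a  = (true  ∷ s , just a ∷ f , g)      , refl
... | isFalse b = (false ∷ s , f , just b ∷ g)      , refl

nthTrue-injective : ∀ {n} (s : Vec Bool n) {a a′} → nthTrue s a ≡ nthTrue s a′ → a ≡ a′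
nthTrue-injective (true  ∷ s) {zero}  {zero}   _  = refl
nthTrue-injective (true  ∷ s) {suc a} {suc a′} eq = cong suc (nthTrue-injective s (Fin.suc-injective eq))
nthTrue-injective (false ∷ s)                  eq = nthTrue-injective s (Fin.suc-injective eq)

nthFalse-injective : ∀ {n} (s : Vec Bool n) {b b′} → nthFalse s b ≡ nthFalse s b′ → b ≡ b′
nthFalse-injective (true  ∷ s)                  eq = nthFalse-injective s (Fin.suc-injective eq)
nthFalse-injective (false ∷ s) {zero}  {zero}   _  = refl
nthFalse-injective (false ∷ s) {suc b} {suc b′} eq = cong suc (nthFalse-injective s (Fin.suc-injective eq))

nthTrue≢nthFalse : ∀ {n} (s : Vec Bool n) a b → nthTrue s a ≢ nthFalse s b
nthTrue≢nthFalse (true  ∷ s) (suc a) b       eq = nthTrue≢nthFalse s a b (Fin.suc-injective eq)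
nthTrue≢nthFalse (false ∷ s) a       (suc b) eq = nthTrue≢nthFalse s a b (Fin.suc-injective eq)

parentOfTrue-injective : ∀ {n} (s : Vec Bool n) {c c′} → parentOfTrue s c ≡ parentOfTrue s c′ → c ≡ c′
parentOfTrue-injective s {nothing} {nothing} _  = refl
parentOfTrue-injective s {nothing} {just _}  eq = ⊥-elim (fromℕ≢inject₁ (just-injective eq))
parentOfTrue-injective s {just _}  {nothing} eq = ⊥-elim (fromℕ≢inject₁ (sym (just-injective eq)))
parentOfTrue-injective s {just _}  {just _}  eq =
  cong just (nthTrue-injective s (inject₁-injective (just-injective eq)))

parentOfFalse-injective : ∀ {n} (s : Vec Bool n) {c c′} → parentOfFalse s c ≡ parentOfFalse s c′ → c ≡ c′
parentOfFalse-injective s {nothing} {nothing} _  = refl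
parentOfFalse-injective s {just _}  {just _}  eq =
  cong just (nthFalse-injective s (inject₁-injective (just-injective eq)))

parentOfTrue≢parentOfFalse : ∀ {n} (s : Vec Bool n) c c′ → parentOfTrue s c ≢ parentOfFalse s c′
parentOfTrue≢parentOfFalse s nothing  (just _) eq = fromℕ≢inject₁ (just-injective eq)
parentOfTrue≢parentOfFalse s (just a) (just b) eq =
  nthTrue≢nthFalse s a b (inject₁-injective (just-injective eq))

merge-injective : ∀ {n} (t t′ : Decomposition n) → merge t ≡ merge t′ → t ≡ t′
merge-injective ([] , [] , []) ([] , [] , []) _ = refl
merge-injective (true ∷ s , c ∷ f , g) (true ∷ s′ , c′ ∷ f′ , g′) eq
  with refl ← merge-injective (s , f , g) (s′ , f′ , g′) (proj₂ (∷-injective eq))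
  with refl ← parentOfTrue-injective s (proj₁ (∷-injective eq)) = refl
merge-injective (true ∷ s , c ∷ f , g) (false ∷ s′ , f′ , c′ ∷ g′) eq
  with refl ← merge-injective (s , f , g) (s′ , f′ , g′) (proj₂ (∷-injective eq)) =
  ⊥-elim (parentOfTrue≢parentOfFalse s c c′ (proj₁ (∷-injective eq)))
merge-injective (false ∷ s , f , c ∷ g) (true ∷ s′ , c′ ∷ f′ , g′) eq
  with refl ← merge-injective (s , f , g) (s′ , f′ , g′) (proj₂ (∷-injective eq)) =
  ⊥-elim (parentOfTrue≢parentOfFalse s c′ c (sym (proj₁ (∷-injective eq))))
merge-injective (false ∷ s , f , c ∷ g) (false ∷ s′ , f′ , c′ ∷ g′) eq
  with refl ← merge-injective (s , f , g) (s′ , f′ , g′) (proj₂ (∷-injective eq))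
  with refl ← parentOfFalse-injective s (proj₁ (∷-injective eq)) = refl

depth-merge-max : ∀ {n} (t : Decomposition n) → depth (merge t) (fromℕ n) ≡ 1
depth-merge-max ([]        , []    , [])    = refl
depth-merge-max (true  ∷ s , c ∷ f , g)     = depth-merge-max (s , f , g)
depth-merge-max (false ∷ s , f     , c ∷ g) = depth-merge-max (s , f , g)

depth-merge-true : ∀ {n} (t : Decomposition n) a →
  depth (merge t) (inject₁ (nthTrue (proj₁ t) a)) ≡ suc (depth (proj₁ (proj₂ t)) a)
depth-merge-true (true  ∷ s , c ∷ f , g)       (suc a) = depth-merge-true (s , f , g) a
depth-merge-true (true  ∷ s , nothing ∷ f , g) zero    = cong suc (depth-merge-max (s , f , g))
depth-merge-true (true  ∷ s , just a ∷ f , g)  zero    = cong suc (depth-merge-true (s , f , g) a)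
depth-merge-true (false ∷ s , f , c ∷ g)       a       = depth-merge-true (s , f , g) a

depth-merge-false : ∀ {n} (t : Decomposition n) b →
  depth (merge t) (inject₁ (nthFalse (proj₁ t) b)) ≡ depth (proj₂ (proj₂ t)) b
depth-merge-false (true  ∷ s , c ∷ f , g)        b       = depth-merge-false (s , f , g) b
depth-merge-false (false ∷ s , f , c ∷ g)        (suc b) = depth-merge-false (s , f , g) b
depth-merge-false (false ∷ s , f , nothing ∷ g)  zero    = refl
depth-merge-false (false ∷ s , f , just b ∷ g)   zero    = cong suc (depth-merge-false (s , f , g) b)

merge-heightAtMost : ∀ {n h} (s : Vec Bool n) {f g} →
  HeightAtMost h f → HeightAtMost (suc h) g → HeightAtMost (suc h) (merge (s , f , g))
merge-heightAtMost s {f} {g} hf hg v with position s v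
... | isMax     rewrite depth-merge-max   (s , f , g)   = s≤s z≤n
... | isTrue a  rewrite depth-merge-true  (s , f , g) a = s≤s (hf a)
... | isFalse b rewrite depth-merge-false (s , f , g) b = hg b

merge-heightAtMost⁻ : ∀ {n h} (s : Vec Bool n) {f g} →
  HeightAtMost (suc h) (merge (s , f , g)) → HeightAtMost h f × HeightAtMost (suc h) g
merge-heightAtMost⁻ s {f} {g} hm =
  (λ a → s≤s⁻¹ (subst (_≤ _) (depth-merge-true (s , f , g) a) (hm (inject₁ (nthTrue s a))))) ,
  (λ b → subst (_≤ _) (depth-merge-false (s , f , g) b) (hm (inject₁ (nthFalse s b))))

length-concatMap : ∀ {A B : Set} (f : A → List B) xs → length (concatMap f xs) ≡ sum (map (length ∘ f) xs)
length-concatMap f []       = refl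
length-concatMap f (x ∷ xs) = trans (length-++ (f x)) (cong (length (f x) +_) (length-concatMap f xs))

length-cartesianProductWith : ∀ {A B C : Set} (f : A → B → C) xs ys →
  length (cartesianProductWith f xs ys) ≡ length xs * length ys
length-cartesianProductWith f []       ys = refl
length-cartesianProductWith f (x ∷ xs) ys =
  trans (length-++ (map (f x) ys)) (cong₂ _+_ (length-map (f x) ys) (length-cartesianProductWith f xs ys))

concatMap-unique : ∀ {A B : Set} {f : A → List B} {xs} → Unique xs → (∀ x → Unique (f x)) →
  (∀ {x x′ y} → y ∈ f x → y ∈ f x′ → x ≡ x′) → Unique (concatMap f xs)
concatMap-unique xs! f! separated =
  Unique.concat⁺ (All.map⁺ (All.universal f! _))
                 (AllPairs.map⁺ (AllPairs.map (λ x≢x′ {_} (y∈fx , y∈fx′) → x≢x′ (separated y∈fx y∈fx′)) xs!))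

-- The fuel only makes the recursion through the sizes trues s, falses s ≤ n
-- structural; it never runs out when n ≤ fuel.
forests : (fuel h n : ℕ) → List (DecForest n)
mergedForests : (fuel h : ℕ) {n : ℕ} (s : Vec Bool n) → List (DecForest (suc n))

forests _          _       zero    = [] ∷ []
forests zero       _       (suc n) = []
forests (suc fuel) zero    (suc n) = []
forests (suc fuel) (suc h) (suc n) = concatMap (mergedForests fuel h) (boolVectors n)

mergedForests fuel h s =
  cartesianProductWith (λ f g → merge (s , f , g)) (forests fuel h (trues s)) (forests fuel (suc h) (falses s))

∈-mergedForests⁻ : ∀ {fuel h n} {s : Vec Bool n} {d} → d ∈ mergedForests fuel h s →
  ∃₂ λ f g → f ∈ forests fuel h (trues s) × g ∈ forests fuel (suc h) (falses s) × d ≡ merge (s , f , g)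
∈-mergedForests⁻ {fuel} {h} {s = s} =
  ∈-cartesianProductWith⁻ (λ f g → merge (s , f , g)) (forests fuel h (trues s)) (forests fuel (suc h) (falses s))

∈-forests⁻ : ∀ fuel h n {d : DecForest n} → d ∈ forests fuel h n → HeightAtMost h d
∈-forests⁻ _          _       zero    {[]} _ ()
∈-forests⁻ (suc fuel) (suc h) (suc n) d∈
  with s , _ , d∈mergedForests ← find (∈-concatMap⁻ (mergedForests fuel h) {boolVectors n} d∈)
  with f , g , f∈ , g∈ , refl ← ∈-mergedForests⁻ {s = s} d∈mergedForests =
  merge-heightAtMost s (∈-forests⁻ fuel h (trues s) f∈) (∈-forests⁻ fuel (suc h) (falses s) g∈)

∈-forests⁺ : ∀ fuel h n (d : DecForest n) → n ≤ fuel → HeightAtMost h d → d ∈ forests fuel h n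
∈-forests⁺ _          _       zero    []  _ _ = here refl
∈-forests⁺ (suc fuel) zero    (suc n) d   _ hd = ⊥-elim (1+n≰n (≤-trans (depth≥1 d zero) (hd zero)))
∈-forests⁺ (suc fuel) (suc h) (suc n) d (s≤s n≤fuel) hd
  with (s , f , g) , refl ← merge-surjective d =
  ∈-concatMap⁺ (mergedForests fuel h) {boolVectors n} (lose (∈-boolVectors s)
    (∈-cartesianProductWith⁺ _
      (∈-forests⁺ fuel h (trues s) f (≤-trans (trues≤ s) n≤fuel) (proj₁ (merge-heightAtMost⁻ s hd)))
      (∈-forests⁺ fuel (suc h) (falses s) g (≤-trans (falses≤ s) n≤fuel) (proj₂ (merge-heightAtMost⁻ s hd)))))

forests-unique : ∀ fuel h n → Unique (forests fuel h n)
forests-unique _          _       zero    = All.[] AllPairs.∷ AllPairs.[]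
forests-unique zero       _       (suc n) = AllPairs.[]
forests-unique (suc fuel) zero    (suc n) = AllPairs.[]
forests-unique (suc fuel) (suc h) (suc n) =
  concatMap-unique (boolVectors-unique n)
    (λ s → Unique.cartesianProductWith⁺ _ merge-injective₂ (forests-unique fuel h (trues s)) (forests-unique fuel (suc h) (falses s)))
    separated
  where
  merge-injective₂ : ∀ {s : Vec Bool n} {f f′ g g′} → merge (s , f , g) ≡ merge (s , f′ , g′) → f ≡ f′ × g ≡ g′
  merge-injective₂ eq with refl ← merge-injective _ _ eq = refl , refl
  separated : ∀ {s s′ d} → d ∈ mergedForests fuel h s → d ∈ mergedForests fuel h s′ → s ≡ s′
  separated {s} {s′} d∈ d∈′
    with _ , _ , _ , _ , refl ← ∈-mergedForests⁻ {s = s} d∈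
    with _ , _ , _ , _ , eq   ← ∈-mergedForests⁻ {s = s′} d∈′ =
    cong proj₁ (merge-injective _ _ eq)

length-forests : ∀ fuel h n → n ≤ fuel → length (forests fuel h n) ≡ decForestCount h n
length-forests _          zero          zero    _ = refl
length-forests _          (suc zero)    zero    _ = refl
length-forests _          (suc (suc h)) zero    _ = refl
length-forests (suc fuel) zero          (suc n) _ = refl
length-forests (suc fuel) (suc h)       (suc n) (s≤s n≤fuel) = begin
  length (forests (suc fuel) (suc h) (suc n))
    ≡⟨ length-concatMap (mergedForests fuel h) (boolVectors n) ⟩
  sum (map (λ s → length (mergedForests fuel h s)) (boolVectors n))
    ≡⟨ cong sum (map-cong blockSize (boolVectors n)) ⟩
  sum (map (λ s → decForestCount h (trues s) * decForestCount (suc h) (falses s)) (boolVectors n))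
    ≡⟨ sum-boolVectors n (λ i j → decForestCount h i * decForestCount (suc h) j) ⟩
  binomialSum n (λ i j → decForestCount h i * decForestCount (suc h) j)
    ≡⟨ decForestCount-suc h n ⟨
  decForestCount (suc h) (suc n)
    ∎
  where
  open ≡-Reasoning
  blockSize : ∀ s → length (mergedForests fuel h s)
                  ≡ decForestCount h (trues s) * decForestCount (suc h) (falses s)
  blockSize s = trans (length-cartesianProductWith _ (forests fuel h (trues s)) _)
    (cong₂ _*_ (length-forests fuel h (trues s) (≤-trans (trues≤ s) n≤fuel))
               (length-forests fuel (suc h) (falses s) (≤-trans (falses≤ s) n≤fuel)))

toParent : ∀ {n} → DecForest n → Parent n
toParent []      = []
toParent (c ∷ d) = Maybe.map suc c ∷ Vec.map (Maybe.map suc) (toParent d)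

Decreasing : ∀ {n} → Parent n → Set
Decreasing {n} p = ∀ (v u : Fin n) → lookup p v ≡ just u → toℕ v < toℕ u

unshift : ∀ {n} → Maybe (Fin (suc n)) → Maybe (Fin n)
unshift nothing        = nothing
unshift (just zero)    = nothing
unshift (just (suc u)) = just u

-- A left inverse of toParent; it discards edges into vertex 0, which a
-- decreasing parent vector does not have.
fromParent : ∀ {n} → Parent n → DecForest n
fromParent []      = []
fromParent (c ∷ p) = unshift c ∷ fromParent (Vec.map unshift p)

unshift-shift : ∀ {n} (x : Maybe (Fin n)) → unshift (Maybe.map suc x) ≡ x
unshift-shift nothing  = refl
unshift-shift (just _) = refl

shift-unshift : ∀ {n} (x : Maybe (Fin (suc n))) → x ≢ just zero → Maybe.map suc (unshift x) ≡ x
shift-unshift nothing        _   = refl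
shift-unshift (just zero)    x≢0 = ⊥-elim (x≢0 refl)
shift-unshift (just (suc _)) _   = refl

unshift≡just : ∀ {n} (x : Maybe (Fin (suc n))) {u} → unshift x ≡ just u → x ≡ just (suc u)
unshift≡just (just (suc _)) refl = refl

map-shift-unshift : ∀ {n m} (q : Vec (Maybe (Fin (suc n))) m) → (∀ w → lookup q w ≢ just zero) →
  Vec.map (Maybe.map suc) (Vec.map unshift q) ≡ q
map-shift-unshift []      _   = refl
map-shift-unshift (x ∷ q) q≢0 = cong₂ _∷_ (shift-unshift x (q≢0 zero)) (map-shift-unshift q (q≢0 ∘ suc))

fromParent-toParent : ∀ {n} (d : DecForest n) → fromParent (toParent d) ≡ d
fromParent-toParent []      = refl
fromParent-toParent (c ∷ d) = cong₂ _∷_ (unshift-shift c) (begin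
  fromParent (Vec.map unshift (Vec.map (Maybe.map suc) (toParent d)))
    ≡⟨ cong fromParent (Vec.map-∘ unshift (Maybe.map suc) (toParent d)) ⟨
  fromParent (Vec.map (unshift ∘ Maybe.map suc) (toParent d))
    ≡⟨ cong fromParent (trans (Vec.map-cong unshift-shift (toParent d)) (Vec.map-id (toParent d))) ⟩
  fromParent (toParent d)
    ≡⟨ fromParent-toParent d ⟩
  d ∎)
  where open ≡-Reasoning

toParent-injective : ∀ {n} {d d′ : DecForest n} → toParent d ≡ toParent d′ → d ≡ d′
toParent-injective {d = d} {d′} eq =
  trans (sym (fromParent-toParent d)) (trans (cong fromParent eq) (fromParent-toParent d′))

toParent-fromParent : ∀ {n} (p : Parent n) → Decreasing p → toParent (fromParent p) ≡ p
toParent-fromParent []      _   = refl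
toParent-fromParent (c ∷ p) dec =
  cong₂ _∷_ (shift-unshift c (λ c≡0 → n≮0 (dec zero zero c≡0)))
            (trans (cong (Vec.map (Maybe.map suc)) (toParent-fromParent (Vec.map unshift p) tailDecreasing))
                   (map-shift-unshift p (λ w pw≡0 → n≮0 (dec (suc w) zero pw≡0))))
  where
  tailDecreasing : Decreasing (Vec.map unshift p)
  tailDecreasing w u eq =
    s≤s⁻¹ (dec (suc w) (suc u) (unshift≡just (lookup p w) (trans (sym (Vec.lookup-map w unshift p)) eq)))

lookup-toParent-suc : ∀ {n} (c : Maybe (Fin n)) d v →
  lookup (toParent (c ∷ d)) (suc v) ≡ Maybe.map suc (lookup (toParent d) v)
lookup-toParent-suc c d v = Vec.lookup-map v (Maybe.map suc) (toParent d)

toParent-decreasing : ∀ {n} (d : DecForest n) → Decreasing (toParent d)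
toParent-decreasing (c ∷ d) (suc v) u eq
  with lookup (toParent d) v in eq′ | trans (sym (lookup-toParent-suc c d v)) eq
... | just w | refl = s≤s (toParent-decreasing d v w eq′)
toParent-decreasing (just w ∷ d) zero .(suc w) refl = s≤s z≤n

depth-root : ∀ {n} (d : DecForest n) v → lookup (toParent d) v ≡ nothing → depth d v ≡ 1
depth-root (c ∷ d) (suc v) eq
  with lookup (toParent d) v in eq′ | trans (sym (lookup-toParent-suc c d v)) eq
... | nothing | _ = depth-root d v eq′
depth-root (nothing ∷ d) zero _ = refl

depth-parent : ∀ {n} (d : DecForest n) v {u} → lookup (toParent d) v ≡ just u → depth d v ≡ suc (depth d u)
depth-parent (c ∷ d) (suc v) eq
  with lookup (toParent d) v in eq′ | trans (sym (lookup-toParent-suc c d v)) eq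
... | just w | refl = depth-parent d v eq′
depth-parent (just w ∷ d) zero refl = refl

upⁿ-+ : ∀ {n} (p : Parent n) m k x → upⁿ p (m + k) x ≡ upⁿ p m (upⁿ p k x)
upⁿ-+ p zero    k x = refl
upⁿ-+ p (suc m) k x = cong (up p) (upⁿ-+ p m k x)

upⁿ-toParent : ∀ {n} (d : DecForest n) m {v u} → upⁿ (toParent d) m (just v) ≡ just u →
  toℕ v + m ≤ toℕ u × depth d u + m ≡ depth d v
upⁿ-toParent d zero refl = ≤-reflexive (+-identityʳ _) , +-identityʳ _
upⁿ-toParent d (suc m) {v} eq with upⁿ (toParent d) m (just v) in eq′
upⁿ-toParent d (suc m) {v} {u} eq | just w =
  ≤-trans (≤-reflexive (+-suc (toℕ v) m)) (≤-trans (s≤s v+m≤w) (toParent-decreasing d w u eq)) ,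
  trans (+-suc (depth d u) m) (trans (cong (_+ m) (sym (depth-parent d w eq))) dw+m≡dv)
  where
  v+m≤w : toℕ v + m ≤ toℕ w
  v+m≤w = proj₁ (upⁿ-toParent d m eq′)
  dw+m≡dv : depth d w + m ≡ depth d v
  dw+m≡dv = proj₂ (upⁿ-toParent d m eq′)

strictAnc-label : ∀ {n} (d : DecForest n) {u v} → StrictAnc (toParent d) u v → toℕ v < toℕ u
strictAnc-label d {v = v} (m , eq) = ≤-trans (m<m+n (toℕ v) (s≤s z≤n)) (proj₁ (upⁿ-toParent d (suc m) eq))

strictAnc-depth : ∀ {n} (d : DecForest n) {u v} → StrictAnc (toParent d) u v → depth d u < depth d v
strictAnc-depth d {u} (m , eq) =
  ≤-trans (m<m+n (depth d u) (s≤s z≤n)) (≤-reflexive (proj₂ (upⁿ-toParent d (suc m) eq)))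

ancestor-exists : ∀ {n} (d : DecForest n) m v → m < depth d v → ∃ λ u → upⁿ (toParent d) m (just v) ≡ just u
ancestor-exists d zero    v _ = v , refl
ancestor-exists d (suc m) v 1+m<depth
  with w , eq ← ancestor-exists d m v (<⇒≤ 1+m<depth)
  with lookup (toParent d) w in eq′
... | just u  = u , trans (cong (up (toParent d)) eq) eq′
... | nothing = ⊥-elim (<-irrefl depth≡1+m 1+m<depth)
  where
  depth≡1+m : suc m ≡ depth d v
  depth≡1+m = trans (cong (_+ m) (sym (depth-root d w eq′))) (proj₂ (upⁿ-toParent d m eq))

-- Pattern avoidance

toParent-isForest : ∀ {n} (d : DecForest n) → IsForest (toParent d)
toParent-isForest {n} d v with upⁿ (toParent d) n (just v) in eq
... | nothing = refl
... | just u  = ⊥-elim (<⇒≱ (toℕ<n u) (≤-trans (m≤n+m n (toℕ v)) (proj₁ (upⁿ-toParent d n eq))))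

toParent-avoids-pat12 : ∀ {n} (d : DecForest n) → Avoids (toParent d) pat12
toParent-avoids-pat12 d (w , inst) with inst zero (suc zero) (s≤s z≤n)
... | ancestor , labels = <-asym (strictAnc-label d ancestor) (Equivalence.from labels (s≤s (s≤s z≤n)))

heightAtMost⇒avoids : ∀ {n} k (d : DecForest n) → HeightAtMost k d → (σ : Fin (suc k) → ℕ) → Avoids (toParent d) σ
heightAtMost⇒avoids k d height σ (w , inst) = 1+n≰n (≤-trans (deep k ≤-refl) (height _))
  where
  deep : ∀ i (i<1+k : i < suc k) → suc i ≤ depth d (w (fromℕ< i<1+k))
  deep zero    _       = depth≥1 d _
  deep (suc i) 1+i<1+k = ≤-trans (s≤s (deep i (<⇒≤ 1+i<1+k))) (strictAnc-depth d (proj₁ (inst _ _ earlier)))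
    where
    earlier : toℕ (fromℕ< (<⇒≤ 1+i<1+k)) < toℕ (fromℕ< 1+i<1+k)
    earlier = subst₂ _<_ (sym (toℕ-fromℕ< (<⇒≤ 1+i<1+k))) (sym (toℕ-fromℕ< 1+i<1+k)) ≤-refl

suc[b∸suc[a]]+[k∸b]≡k∸a : ∀ {a b k} → a < b → b ≤ k → suc (b ∸ suc a) + (k ∸ b) ≡ k ∸ a
suc[b∸suc[a]]+[k∸b]≡k∸a {zero}  {suc b} {suc k} _         (s≤s b≤k) = m+[n∸m]≡n (s≤s b≤k)
suc[b∸suc[a]]+[k∸b]≡k∸a {suc a} {suc b} {suc k} (s≤s a<b) (s≤s b≤k) = suc[b∸suc[a]]+[k∸b]≡k∸a a<b b≤k

-- A vertex of depth > k and its ancestors at distances k, k-1, …, 0 form an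
-- instance of k+1 ⋯ 1, since labels decrease downwards.
avoids-patDec⇒heightAtMost : ∀ {n} k (d : DecForest n) → Avoids (toParent d) (patDec (suc k)) → HeightAtMost k d
avoids-patDec⇒heightAtMost {n} k d avoids v with depth d v ≤? k
... | yes shallow = shallow
... | no deep     = ⊥-elim (avoids (w , chain))
  where
  p : Parent n
  p = toParent d
  k∸a<depth : ∀ (a : Fin (suc k)) → k ∸ toℕ a < depth d v
  k∸a<depth a = ≤-<-trans (m∸n≤m k (toℕ a)) (≰⇒> deep)
  w : Fin (suc k) → Fin n
  w a = proj₁ (ancestor-exists d (k ∸ toℕ a) v (k∸a<depth a))
  w-ancestor : ∀ a → upⁿ p (k ∸ toℕ a) (just v) ≡ just (w a)
  w-ancestor a = proj₂ (ancestor-exists d (k ∸ toℕ a) v (k∸a<depth a))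
  chain : Instance p (patDec (suc k)) w
  chain a b a<b = ancestor , mk⇔ (λ wa<wb → ⊥-elim (<-asym wa<wb (strictAnc-label d ancestor)))
                                  (λ σa<σb → ⊥-elim (<⇒≱ σa<σb (∸-monoʳ-≤ (suc k) (<⇒≤ a<b))))
    where
    m : ℕ
    m = toℕ b ∸ suc (toℕ a)
    ancestor : StrictAnc p (w a) (w b)
    ancestor = m , (begin
      upⁿ p (suc m) (just (w b))                      ≡⟨ cong (upⁿ p (suc m)) (w-ancestor b) ⟨
      upⁿ p (suc m) (upⁿ p (k ∸ toℕ b) (just v))      ≡⟨ upⁿ-+ p (suc m) (k ∸ toℕ b) (just v) ⟨
      upⁿ p (suc m + (k ∸ toℕ b)) (just v)            ≡⟨ cong (λ x → upⁿ p x (just v)) (suc[b∸suc[a]]+[k∸b]≡k∸a a<b (s≤s⁻¹ (toℕ<n b))) ⟩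
      upⁿ p (k ∸ toℕ a) (just v)                      ≡⟨ w-ancestor a ⟩
      just (w a)                                      ∎)
      where open ≡-Reasoning

avoids-pat12⇒decreasing : ∀ {n} (p : Parent n) → IsForest p → Avoids p pat12 → Decreasing p
avoids-pat12⇒decreasing {n} p forest avoids v u pv≡u with <-cmp (toℕ v) (toℕ u)
... | tri< v<u _ _ = v<u
... | tri≈ _ v≡u _ = ⊥-elim (noSelfLoop (subst (λ x → lookup p v ≡ just x) (sym (toℕ-injective v≡u)) pv≡u))
  where
  loop : lookup p v ≡ just v → ∀ m → upⁿ p m (just v) ≡ just v
  loop pv≡v zero    = refl
  loop pv≡v (suc m) = trans (cong (up p) (loop pv≡v m)) pv≡v
  noSelfLoop : lookup p v ≡ just v → ⊥
  noSelfLoop pv≡v with () ← trans (sym (loop pv≡v n)) (forest v)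
... | tri> _ _ u<v = ⊥-elim (avoids (w , parentChild))
  where
  w : Fin 2 → Fin n
  w zero       = u
  w (suc zero) = v
  parentChild : Instance p pat12 w
  parentChild zero       (suc zero) _ = (0 , pv≡u) , mk⇔ (λ _ → s≤s (s≤s z≤n)) (λ _ → u<v)
  parentChild zero       zero       ()
  parentChild (suc zero) zero       ()
  parentChild (suc zero) (suc zero) (s≤s ())

∈-map-toParent-forests : ∀ k n (p : Parent n) →
  (p ∈ map toParent (forests n k n)) ⇔ (IsForest p × Avoids p pat12 × Avoids p (patDec (suc k)))
∈-map-toParent-forests k n p = mk⇔ sound complete
  where
  sound : p ∈ map toParent (forests n k n) → IsForest p × Avoids p pat12 × Avoids p (patDec (suc k))
  sound p∈ with d , d∈ , refl ← ∈-map⁻ toParent p∈ =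
    toParent-isForest d , toParent-avoids-pat12 d , heightAtMost⇒avoids k d (∈-forests⁻ n k n d∈) (patDec (suc k))
  complete : IsForest p × Avoids p pat12 × Avoids p (patDec (suc k)) → p ∈ map toParent (forests n k n)
  complete (forest , avoids12 , avoidsDec) =
    subst (_∈ map toParent (forests n k n)) p≡
      (∈-map⁺ toParent (∈-forests⁺ n k n (fromParent p) ≤-refl
        (avoids-patDec⇒heightAtMost k (fromParent p) (subst (λ q → Avoids q (patDec (suc k))) (sym p≡) avoidsDec))))
    where
    p≡ : toParent (fromParent p) ≡ p
    p≡ = toParent-fromParent p (avoids-pat12⇒decreasing p forest avoids12)

proposition3p1 : (k : ℕ) → 2 ≤ k → (n : ℕ) →
    Σ (List (Parent n)) λ xs →
      Unique xs
      × (∀ (p : Parent n) → (p ∈ xs) ⇔ (IsForest p × Avoids p pat12 × Avoids p (patDec k)))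
      × length xs ≡ S (k ∸ 2) n
proposition3p1 (suc (suc k)) (s≤s (s≤s z≤n)) n =
  map toParent (forests n (suc k) n) ,
  Unique.map⁺ toParent-injective (forests-unique n (suc k) n) ,
  ∈-map-toParent-forests (suc k) n ,
  trans (length-map toParent (forests n (suc k) n)) (length-forests n (suc k) n ≤-refl)
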